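{- Let $A\in\operatorname{M}_n(\mathbb{Z})$ be non-singular and $\mathcal R=\mathbb{Z}[1/\det A]$. Then $$G_A=\bigcap_{p}\left(\mathbb{Q}^n\cap\overline G_{A,p}\right)=\bigcap_{p\mid\det A}\left(\mathcal R^n\cap\overline G_{A,p}\right),$$ where the first intersection runs over all primes $p$, the second over the primes dividing $\det A$, and $\mathbb{Q}^n$ is regarded as a subset of $\mathbb{Q}_p^n$.
   Context: $G_A=\{A^{ -k}\mathbf x:\mathbf x\in\mathbb{Z}^n,k\in\mathbb{Z}\}\subseteq\mathbb{Q}^n$. For a prime $p$, $\overline G_{A,p}=G_A\otimes_{\mathbb{Z}}\mathbb{Z}_p$, identified with the $\mathbb{Z}_p$-submodule of $\mathbb{Q}_p^n$ generated by $G_A$. An empty intersection of sets of the form $\mathcal R^n\cap(\cdot)$ is understood as $\mathcal R^n$. -}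

module Defs where

open import Data.Nat as ℕ using (ℕ; zero; suc)
open import Data.Nat.Divisibility using (_∣_)
open import Data.Integer as ℤ using (ℤ; +_; -[1+_])
import Data.Integer.Divisibility as ℤD
open import Data.Rational as ℚ using (ℚ; _/_)
open import Data.Fin using (Fin; punchIn) renaming (zero to fz; suc to fs)
open import Data.Product using (Σ; _×_; _,_)
open import Relation.Nullary using (¬_)
open import Relation.Binary.PropositionalEquality using (_≡_)

Vecℚ : ℕ → Set
Vecℚ n = Fin n → ℚ

Vecℤ : ℕ → Set
Vecℤ n = Fin n → ℤ

Mat : ℕ → Set
Mat n = Fin n → Fin n → ℤ

ι : ℤ → ℚ
ι a = a / 1

sumℤ : ∀ {k} → (Fin k → ℤ) → ℤ
sumℤ {zero}  f = + 0
sumℤ {suc k} f = f fz ℤ.+ sumℤ (λ i → f (fs i))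

sumℚ : ∀ {k} → (Fin k → ℚ) → ℚ
sumℚ {zero}  f = ℚ.0ℚ
sumℚ {suc k} f = f fz ℚ.+ sumℚ (λ i → f (fs i))

sign : ℕ → ℤ
sign zero = + 1
sign (suc zero) = -[1+ 0 ]
sign (suc (suc m)) = sign m

det : ∀ {n} → Mat n → ℤ
det {zero}  M = + 1
det {suc n} M = sumℤ (λ j → sign (Data.Fin.toℕ j) ℤ.* (M fz j ℤ.* det (λ r c → M (fs r) (punchIn j c))))

_·ᵥ_ : ∀ {n} → Mat n → Vecℚ n → Vecℚ n
(A ·ᵥ v) i = sumℚ (λ j → ι (A i j) ℚ.* v j)

pow·ᵥ : ∀ {n} → ℕ → Mat n → Vecℚ n → Vecℚ n
pow·ᵥ zero    A v = v
pow·ᵥ (suc m) A v = A ·ᵥ pow·ᵥ m A v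

toℚᵛ : ∀ {n} → Vecℤ n → Vecℚ n
toℚᵛ x i = ι (x i)

-- v = A^{-k} x  (A non-singular, so for k = m ≥ 0 this means A^m v = x;
-- for k = -(m+1) it means v = A^{m+1} x)
IsInvPow : ∀ {n} → Mat n → ℤ → Vecℤ n → Vecℚ n → Set
IsInvPow A (+ m)      x v = ∀ i → pow·ᵥ m A v i ≡ ι (x i)
IsInvPow A -[1+ m ]   x v = ∀ i → v i ≡ pow·ᵥ (suc m) A (toℚᵛ x) i

G : ∀ {n} → Mat n → Vecℚ n → Set
G {n} A v = Σ ℤ λ k → Σ (Vecℤ n) λ x → IsInvPow A k x v

InR : ∀ {n} → ℤ → Vecℚ n → Set
InR d v = ∀ i → Σ ℤ λ a → Σ ℕ λ k → ι (d ℤ.^ k) ℚ.* v i ≡ ι a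

-- p-adic integers ℤ_p = lim ℤ/p^m, as coherent sequences of integer representatives
record ℤₚ (p : ℕ) : Set where
  field
    seq : ℕ → ℤ
    coh : ∀ m → (+ (p ℕ.^ m)) ℤD.∣ (seq (suc m) ℤ.- seq m)

-- q ∈ p^N ℤ_(p)  (q = a p^N / b with p ∤ b)
InPpow : ℕ → ℕ → ℚ → Set
InPpow p N q = Σ ℤ λ a → Σ ℕ λ b → (¬ (p ∣ suc b)) × (q ≡ (a ℤ.* + (p ℕ.^ N)) / suc b)

-- The element Σ_i c_i g_i of ℚ_p^n (c_i ∈ ℤ_p, g_i ∈ ℚ^n) equals v ∈ ℚ^n ⊆ ℚ_p^n:
-- the partial approximations Σ_i c_i(m) g_i converge p-adically to v.
LinCombEq : ∀ {n k} (p : ℕ) → (Fin k → ℤₚ p) → (Fin k → Vecℚ n) → Vecℚ n → Set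
LinCombEq p c g v =
  ∀ N → Σ ℕ λ M → ∀ m → M ℕ.≤ m → ∀ j →
    InPpow p N (v j ℚ.- sumℚ (λ i → ι (ℤₚ.seq (c i) m) ℚ.* g i j))

-- v ∈ ℚ^n ∩ \bar G_{A,p}: v is a ℤ_p-linear combination (in ℚ_p^n) of finitely many elements of G_A
InGbar : ∀ {n} → Mat n → ℕ → Vecℚ n → Set
InGbar {n} A p v =
  Σ ℕ λ k → Σ (Fin k → Vecℚ n) λ g → Σ (Fin k → ℤₚ p) λ c →
    (∀ i → G A (g i)) × LinCombEq p c g v

{-# OPTIONS --safe #-}
-- A vector v lies in G_A iff Aᴷ v ∈ ℤⁿ for some K ≥ 0 (vectors A⁻ᵏ x with k < 0 are integral).
-- If v ∈ Ḡ_{A,p}, truncating its p-adic coefficients at precision p⁰ writes v as an integer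
-- combination of finitely many elements of G_A plus a vector in ℤ₍ₚ₎ⁿ; a common power of A makes
-- those elements integral, so Aᴷ v ∈ ℤ₍ₚ₎ⁿ for all large K. Only the primes dividing a denominator
-- of v impose a condition, so one K serves every prime, and a rational lying in every ℤ₍ₚ₎ is an
-- integer. For the second description, ℤ[1/det A] ⊆ ℤ₍ₚ₎ when p ∤ det A, and G_A ⊆ ℤ[1/det A]ⁿ by
-- Cramer's rule: det A · w is an integral combination of the entries of A w.
module Submission where

open import Defs
open import Data.Nat using (ℕ)
open import Data.Nat.Divisibility using (_∣_)
open import Data.Nat.Primality using (Prime)
open import Data.Integer using (ℤ; ∣_∣; +_)
open import Data.Product using (_×_)
open import Function.Bundles using (_⇔_)
open import Relation.Binary.PropositionalEquality using (_≢_)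

open import Algebra.Bundles using (CommutativeMonoid; CommutativeRing)
open import Data.Fin as Fin using (Fin; toℕ; punchIn; punchOut; _≟_) renaming (zero to fz; suc to fs)
open import Data.Fin.Properties as FinP using (punchInᵢ≢i; punchIn-punchOut; punchIn-injective)
open import Data.List using ([]; _∷_)
open import Data.List.Relation.Unary.All using (_∷_)
open import Data.Maybe using (nothing)
open import Data.Nat as ℕ using (zero; suc)
import Data.Nat.Coprimality as ℕC
import Data.Nat.Divisibility as ℕD
open import Data.Nat.ListAction using (product)
import Data.Nat.Primality as ℕPr
import Data.Nat.Primality.Factorisation as ℕF
import Data.Nat.Properties as ℕP
import Data.Integer as ℤ
import Data.Integer.Properties as ℤP
import Data.Integer.Tactic.RingSolver as ℤ-Solver
open import Data.Product using (Σ; _,_; proj₁; proj₂)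
open import Data.Rational as ℚ using (ℚ; mkℚ; _/_)
import Data.Rational.Properties as ℚP
import Data.Rational.Unnormalised as ℚᵘ
import Data.Rational.Unnormalised.Properties as ℚᵘP
open import Data.Sum using (_⊎_; inj₁; inj₂; [_,_]′)
open import Data.Vec.Functional using (updateAt; removeAt)
open import Data.Vec.Functional.Properties using (updateAt-updates; updateAt-minimal; updateAt-id-local; updateAt-commutes)
open import Function using (_∘_; case_of_)
open import Function.Bundles using (mk⇔)
open import Relation.Binary.Definitions using (tri<; tri≈; tri>)
import Relation.Binary.PropositionalEquality as ≡
open ≡ using (_≡_)
open import Relation.Nullary using (¬_; yes; no; contradiction)
open import Relation.Nullary.Decidable using (recompute)
open import Relation.Nullary.Negation using (¬∃⟶∀¬)
open import Tactic.RingSolver using (solve-∀)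
open import Tactic.RingSolver.Core.AlmostCommutativeRing using (AlmostCommutativeRing; fromCommutativeRing)

-- Determinants over a commutative ring

Adjacent : ∀ {n} → Fin n → Fin n → Set
Adjacent a b = toℕ b ≡ suc (toℕ a)

Adjacent⇒≢ : ∀ {n} {a b : Fin n} → Adjacent a b → a ≢ b
Adjacent⇒≢ b=1+a ≡.refl = ℕP.1+n≢n (≡.sym b=1+a)

punchOut-Adjacent : ∀ {n} {c a b : Fin (suc n)} (c≢a : c ≢ a) (c≢b : c ≢ b) →
                    Adjacent a b → Adjacent (punchOut c≢a) (punchOut c≢b)
punchOut-Adjacent {c = fz} {fz} c≢a c≢b _ = contradiction ≡.refl c≢a
punchOut-Adjacent {c = fz} {fs a} {fs b} c≢a c≢b b=1+a = ℕP.suc-injective b=1+a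
punchOut-Adjacent {c = fs fz} {fz} {fs fz} c≢a c≢b _ = contradiction ≡.refl c≢b
punchOut-Adjacent {c = fs (fs fz)} {fz} {fs fz} c≢a c≢b _ = ≡.refl
punchOut-Adjacent {c = fs (fs (fs c))} {fz} {fs fz} c≢a c≢b _ = ≡.refl
punchOut-Adjacent {n = suc n} {c = fs c} {fs a} {fs b} c≢a c≢b b=1+a =
  ≡.cong suc (punchOut-Adjacent (c≢a ∘ ≡.cong fs) (c≢b ∘ ≡.cong fs) (ℕP.suc-injective b=1+a))

punchIn-Adjacent : ∀ {n} {a b : Fin (suc n)} → Adjacent a b → ∀ k →
                   punchIn a k ≡ punchIn b k ⊎ (punchIn a k ≡ b × punchIn b k ≡ a)
punchIn-Adjacent {a = fz} {fs fz} _ fz = inj₂ (≡.refl , ≡.refl)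
punchIn-Adjacent {a = fz} {fs fz} _ (fs k) = inj₁ ≡.refl
punchIn-Adjacent {a = fs a} {fs b} _ fz = inj₁ ≡.refl
punchIn-Adjacent {a = fs a} {fs b} b=1+a (fs k) with punchIn-Adjacent {a = a} {b} (ℕP.suc-injective b=1+a) k
... | inj₁ eq = inj₁ (≡.cong fs eq)
... | inj₂ (eq₁ , eq₂) = inj₂ (≡.cong fs eq₁ , ≡.cong fs eq₂)

<⇒distance : ∀ {m n} → m ℕ.< n → Σ ℕ λ d → n ≡ suc (d ℕ.+ m)
<⇒distance {m} m<n = let d , 1+m+d=n = ℕP.m≤n⇒∃[o]m+o≡n m<n in
  d , ≡.sym (≡.trans (≡.cong suc (ℕP.+-comm d m)) 1+m+d=n)

module FiniteSums {c ℓ} (M : CommutativeMonoid c ℓ) where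
  open CommutativeMonoid M renaming (_∙_ to _+_; ε to 0#; ∙-congˡ to +-congˡ)
  open import Algebra.Properties.CommutativeMonoid.Sum M using (sum; sum-remove; sum-cong-≋; sum-replicate-zero)
  open import Relation.Binary.Reasoning.Setoid setoid

  sum-single : ∀ {n} (f : Fin n → Carrier) a → (∀ c → c ≢ a → f c ≈ 0#) → sum f ≈ f a
  sum-single {suc n} f a f≈0 = begin
    sum f                     ≈⟨ sum-remove {i = a} f ⟩
    f a + sum (removeAt f a)  ≈⟨ +-congˡ (trans (sum-cong-≋ (λ k → f≈0 _ (punchInᵢ≢i a k))) (sum-replicate-zero n)) ⟩
    f a + 0#                  ≈⟨ identityʳ (f a) ⟩
    f a                       ∎

  sum-pair : ∀ {n} (f : Fin n → Carrier) {a b} → a ≢ b → (∀ c → c ≢ a → c ≢ b → f c ≈ 0#) → sum f ≈ f a + f b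
  sum-pair {suc n} f {a} {b} a≢b f≈0 = begin
    sum f                     ≈⟨ sum-remove {i = a} f ⟩
    f a + sum (removeAt f a)  ≈⟨ +-congˡ (sum-single (removeAt f a) (punchOut a≢b) others) ⟩
    f a + f (punchIn a (punchOut a≢b)) ≡⟨ ≡.cong (λ c → f a + f c) (punchIn-punchOut a≢b) ⟩
    f a + f b                 ∎
    where
    others : ∀ k → k ≢ punchOut a≢b → f (punchIn a k) ≈ 0#
    others k k≢ = f≈0 _ (punchInᵢ≢i a k) (λ eq → k≢ (punchIn-injective a k _ (≡.trans eq (≡.sym (punchIn-punchOut a≢b)))))

module Determinant {c ℓ} (R : CommutativeRing c ℓ) where
  open CommutativeRing R
  open import Algebra.Properties.Ring ring using (-0#≈0#; +-inverseʳ-unique)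
  open import Algebra.Properties.CommutativeSemigroup *-commutativeSemigroup using (x∙yz≈y∙xz)
  open import Algebra.Properties.Semiring.Sum semiring using (sum; sum-cong-≋; ∑-distrib-+; *-distribˡ-sum)
  open FiniteSums +-commutativeMonoid using (sum-single; sum-pair)
  open import Algebra.Solver.Ring.NaturalCoefficients.Default commutativeSemiring using (solve; _:+_; _:*_; _:=_)
  open import Relation.Binary.Reasoning.Setoid setoid

  private
    variable
      n : ℕ

  Matrix : ℕ → Set c
  Matrix n = Fin n → Fin n → Carrier

  _*ᵥ_ : Matrix n → (Fin n → Carrier) → Fin n → Carrier
  (M *ᵥ w) i = sum (λ j → M i j * w j)

  _[_]≔_ : Matrix n → Fin n → (Fin n → Carrier) → Matrix n
  (M [ j ]≔ u) r = updateAt (M r) j (λ _ → u r)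

  *ᵥ-cong : (M : Matrix n) {u w : Fin n → Carrier} → (∀ j → u j ≈ w j) → ∀ i → (M *ᵥ u) i ≈ (M *ᵥ w) i
  *ᵥ-cong M u≈w i = sum-cong-≋ (λ j → *-congˡ (u≈w j))

  *ᵥ-distrib-+ : (M : Matrix n) (u w : Fin n → Carrier) → ∀ i → (M *ᵥ (λ j → u j + w j)) i ≈ (M *ᵥ u) i + (M *ᵥ w) i
  *ᵥ-distrib-+ M u w i = trans (sum-cong-≋ (λ j → distribˡ (M i j) (u j) (w j))) (∑-distrib-+ (λ j → M i j * u j) (λ j → M i j * w j))

  *ᵥ-scale : (M : Matrix n) (c : Carrier) (u : Fin n → Carrier) → ∀ i → (M *ᵥ (λ j → c * u j)) i ≈ c * (M *ᵥ u) i
  *ᵥ-scale M c u i = trans (sum-cong-≋ (λ j → x∙yz≈y∙xz (M i j) c (u j))) (sym (*-distribˡ-sum c (λ j → M i j * u j)))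

  -1^_ : ℕ → Carrier
  -1^ zero    = 1#
  -1^ (suc k) = - (-1^ k)

  minor : Fin (suc n) → Matrix (suc n) → Matrix n
  minor c M r k = M (fs r) (punchIn c k)

  Det : Matrix n → Carrier
  Det {zero}  M = 1#
  Det {suc n} M = sum (λ c → -1^ toℕ c * (M fz c * Det (minor c M)))

  laplace-term : Matrix (suc n) → Fin (suc n) → Carrier
  laplace-term M c = -1^ toℕ c * (M fz c * Det (minor c M))

  Det-cong : {M N : Matrix n} → (∀ r c → M r c ≈ N r c) → Det M ≈ Det N
  Det-cong {zero}  M≈N = refl
  Det-cong {suc n} M≈N = sum-cong-≋ (λ c → *-congˡ { -1^ toℕ c } (*-cong (M≈N fz c) (Det-cong (λ r k → M≈N (fs r) (punchIn c k)))))

  Det-cong-≡ : {M N : Matrix n} → (∀ r c → M r c ≡ N r c) → Det M ≈ Det N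
  Det-cong-≡ M≡N = Det-cong (λ r c → reflexive (M≡N r c))

  module _ (M : Matrix n) (j : Fin n) where

    []≔-updates : ∀ u r → (M [ j ]≔ u) r j ≡ u r
    []≔-updates u r = updateAt-updates j (M r)

    []≔-minimal : ∀ u r {c} → c ≢ j → (M [ j ]≔ u) r c ≡ M r c
    []≔-minimal u r {c} c≢j = updateAt-minimal c j (M r) c≢j

    []≔-self : ∀ r c → (M [ j ]≔ (λ r → M r j)) r c ≡ M r c
    []≔-self r = updateAt-id-local j (M r) ≡.refl

    []≔-cong : ∀ {u w} → (∀ r → u r ≈ w r) → ∀ r c → (M [ j ]≔ u) r c ≈ (M [ j ]≔ w) r c
    []≔-cong {u} {w} u≈w r c with c ≟ j
    ... | yes ≡.refl = begin
      (M [ j ]≔ u) r j ≡⟨ []≔-updates u r ⟩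
      u r              ≈⟨ u≈w r ⟩
      w r              ≡⟨ []≔-updates w r ⟨
      (M [ j ]≔ w) r j ∎
    ... | no c≢j = reflexive (≡.trans ([]≔-minimal u r c≢j) (≡.sym ([]≔-minimal w r c≢j)))

  []≔-comm : (M : Matrix n) {a b : Fin n} → a ≢ b → ∀ x y r c →
             ((M [ a ]≔ x) [ b ]≔ y) r c ≡ ((M [ b ]≔ y) [ a ]≔ x) r c
  []≔-comm M {a} {b} a≢b x y r c = ≡.sym (updateAt-commutes a b a≢b (M r) c)

  Det-[]≔-cong : (M : Matrix n) (j : Fin n) {u w : Fin n → Carrier} → (∀ r → u r ≈ w r) →
                 Det (M [ j ]≔ u) ≈ Det (M [ j ]≔ w)
  Det-[]≔-cong M j u≈w = Det-cong ([]≔-cong M j u≈w)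

  module _ (M : Matrix (suc n)) {j : Fin (suc n)} (u : Fin (suc n) → Carrier) where

    minor-[]≔-same : ∀ r k → minor j (M [ j ]≔ u) r k ≡ minor j M r k
    minor-[]≔-same r k = []≔-minimal M j u (fs r) (punchInᵢ≢i j k)

    minor-[]≔-other : ∀ {c} (c≢j : c ≢ j) r k →
                      minor c (M [ j ]≔ u) r k ≡ (minor c M [ punchOut c≢j ]≔ (u ∘ fs)) r k
    minor-[]≔-other {c} c≢j r k with k ≟ punchOut c≢j
    ... | yes ≡.refl = ≡.trans (≡.cong ((M [ j ]≔ u) (fs r)) (punchIn-punchOut c≢j))
      (≡.trans ([]≔-updates M j u (fs r)) (≡.sym ([]≔-updates (minor c M) (punchOut c≢j) (u ∘ fs) r)))
    ... | no k≢ = ≡.trans ([]≔-minimal M j u (fs r) punchIn≢j) (≡.sym ([]≔-minimal (minor c M) (punchOut c≢j) (u ∘ fs) r k≢))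
      where
      punchIn≢j : punchIn c k ≢ j
      punchIn≢j eq = k≢ (punchIn-injective c k _ (≡.trans eq (≡.sym (punchIn-punchOut c≢j))))

  private
    expand-term-top : ∀ s a b x y D → s * ((a * x + b * y) * D) ≈ a * (s * (x * D)) + b * (s * (y * D))
    expand-term-top = solve 6 (λ s a b x y D →
      s :* ((a :* x :+ b :* y) :* D) := a :* (s :* (x :* D)) :+ b :* (s :* (y :* D))) refl
    expand-term-minor : ∀ s a b x D₁ D₂ → s * (x * (a * D₁ + b * D₂)) ≈ a * (s * (x * D₁)) + b * (s * (x * D₂))
    expand-term-minor = solve 6 (λ s a b x D₁ D₂ →
      s :* (x :* (a :* D₁ :+ b :* D₂)) := a :* (s :* (x :* D₁)) :+ b :* (s :* (x :* D₂))) refl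

  Det-linear : (M : Matrix n) (j : Fin n) (a b : Carrier) (u w : Fin n → Carrier) →
               Det (M [ j ]≔ (λ r → a * u r + b * w r)) ≈ a * Det (M [ j ]≔ u) + b * Det (M [ j ]≔ w)
  Det-linear {suc n} M j a b u w = begin
    sum (term (M [ j ]≔ v))                                            ≈⟨ sum-cong-≋ termwise ⟩
    sum (λ c → a * term (M [ j ]≔ u) c + b * term (M [ j ]≔ w) c)
      ≈⟨ ∑-distrib-+ (λ c → a * term (M [ j ]≔ u) c) (λ c → b * term (M [ j ]≔ w) c) ⟩
    sum (λ c → a * term (M [ j ]≔ u) c) + sum (λ c → b * term (M [ j ]≔ w) c)
      ≈⟨ +-cong (*-distribˡ-sum a (term (M [ j ]≔ u))) (*-distribˡ-sum b (term (M [ j ]≔ w))) ⟨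
    a * Det (M [ j ]≔ u) + b * Det (M [ j ]≔ w)                        ∎
    where
    v : Fin (suc n) → Carrier
    v r = a * u r + b * w r
    term : Matrix (suc n) → Fin (suc n) → Carrier
    term = laplace-term
    term-cong : ∀ N c {x D} → N fz c ≈ x → Det (minor c N) ≈ D → term N c ≈ -1^ toℕ c * (x * D)
    term-cong N c x≈ D≈ = *-congˡ (*-cong x≈ D≈)
    termwise : ∀ c → term (M [ j ]≔ v) c ≈ a * term (M [ j ]≔ u) c + b * term (M [ j ]≔ w) c
    termwise c with c ≟ j
    ... | yes ≡.refl = begin
      term (M [ j ]≔ v) j
        ≈⟨ term-cong (M [ j ]≔ v) j (reflexive ([]≔-updates M j v fz)) (Det-cong-≡ (minor-[]≔-same M v)) ⟩
      -1^ toℕ j * (v fz * Det (minor j M))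
        ≈⟨ expand-term-top (-1^ toℕ j) a b (u fz) (w fz) (Det (minor j M)) ⟩
      a * (-1^ toℕ j * (u fz * Det (minor j M))) + b * (-1^ toℕ j * (w fz * Det (minor j M)))
        ≈⟨ +-cong (*-congˡ (term-cong (M [ j ]≔ u) j (reflexive ([]≔-updates M j u fz)) (Det-cong-≡ (minor-[]≔-same M u))))
                  (*-congˡ (term-cong (M [ j ]≔ w) j (reflexive ([]≔-updates M j w fz)) (Det-cong-≡ (minor-[]≔-same M w)))) ⟨
      a * term (M [ j ]≔ u) c + b * term (M [ j ]≔ w) c ∎
    ... | no c≢j = begin
      term (M [ j ]≔ v) c
        ≈⟨ term-cong (M [ j ]≔ v) c (reflexive ([]≔-minimal M j v fz c≢j))
             (trans (Det-cong-≡ (minor-[]≔-other M v c≢j)) (Det-linear (minor c M) j′ a b (u ∘ fs) (w ∘ fs))) ⟩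
      -1^ toℕ c * (M fz c * (a * Det (minor c M [ j′ ]≔ (u ∘ fs)) + b * Det (minor c M [ j′ ]≔ (w ∘ fs))))
        ≈⟨ expand-term-minor (-1^ toℕ c) a b (M fz c) _ _ ⟩
      a * (-1^ toℕ c * (M fz c * Det (minor c M [ j′ ]≔ (u ∘ fs))))
        + b * (-1^ toℕ c * (M fz c * Det (minor c M [ j′ ]≔ (w ∘ fs))))
        ≈⟨ +-cong (*-congˡ (term-cong (M [ j ]≔ u) c (reflexive ([]≔-minimal M j u fz c≢j)) (Det-cong-≡ (minor-[]≔-other M u c≢j))))
                  (*-congˡ (term-cong (M [ j ]≔ w) c (reflexive ([]≔-minimal M j w fz c≢j)) (Det-cong-≡ (minor-[]≔-other M w c≢j)))) ⟨
      a * term (M [ j ]≔ u) c + b * term (M [ j ]≔ w) c ∎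
      where
      j′ : Fin n
      j′ = punchOut c≢j

  Det-additive : (M : Matrix n) (j : Fin n) (u w : Fin n → Carrier) →
                 Det (M [ j ]≔ (λ r → u r + w r)) ≈ Det (M [ j ]≔ u) + Det (M [ j ]≔ w)
  Det-additive M j u w = begin
    Det (M [ j ]≔ (λ r → u r + w r))
      ≈⟨ Det-[]≔-cong M j (λ r → sym (+-cong (*-identityˡ (u r)) (*-identityˡ (w r)))) ⟩
    Det (M [ j ]≔ (λ r → 1# * u r + 1# * w r))       ≈⟨ Det-linear M j 1# 1# u w ⟩
    1# * Det (M [ j ]≔ u) + 1# * Det (M [ j ]≔ w)    ≈⟨ +-cong (*-identityˡ _) (*-identityˡ _) ⟩
    Det (M [ j ]≔ u) + Det (M [ j ]≔ w)              ∎

  Det-adjacent-alternating : (M : Matrix n) {a b : Fin n} → Adjacent a b →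
                             (∀ r → M r a ≈ M r b) → Det M ≈ 0#
  Det-adjacent-alternating {suc n} M {a} {b} b=1+a cols = begin
    sum term                    ≈⟨ sum-pair term (Adjacent⇒≢ b=1+a) vanishes ⟩
    term a + term b             ≈⟨ +-congˡ (*-cong (reflexive (≡.cong -1^_ b=1+a)) (*-cong (sym (cols fz)) (Det-cong minors))) ⟩
    term a + - s * (M fz a * D) ≈⟨ distribʳ _ s (- s) ⟨
    (s + - s) * (M fz a * D)    ≈⟨ *-congʳ (-‿inverseʳ s) ⟩
    0# * (M fz a * D)           ≈⟨ zeroˡ _ ⟩
    0#                          ∎
    where
    term : Fin (suc n) → Carrier
    term = laplace-term M
    s D : Carrier
    s = -1^ toℕ a
    D = Det (minor a M)
    minors : ∀ r k → minor b M r k ≈ minor a M r k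
    minors r k with punchIn-Adjacent b=1+a k
    ... | inj₁ eq = reflexive (≡.cong (M (fs r)) (≡.sym eq))
    ... | inj₂ (eq₁ , eq₂) = trans (reflexive (≡.cong (M (fs r)) eq₂)) (trans (cols (fs r)) (reflexive (≡.cong (M (fs r)) (≡.sym eq₁))))
    vanishes : ∀ c → c ≢ a → c ≢ b → term c ≈ 0#
    vanishes c c≢a c≢b = begin
      -1^ toℕ c * (M fz c * Det (minor c M))
        ≈⟨ *-congˡ (*-congˡ (Det-adjacent-alternating (minor c M) (punchOut-Adjacent c≢a c≢b b=1+a) minor-cols)) ⟩
      -1^ toℕ c * (M fz c * 0#)              ≈⟨ trans (*-congˡ (zeroʳ _)) (zeroʳ _) ⟩
      0#                                        ∎
      where
      minor-cols : ∀ r → minor c M r (punchOut c≢a) ≈ minor c M r (punchOut c≢b)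
      minor-cols r = begin
        M (fs r) (punchIn c (punchOut c≢a)) ≡⟨ ≡.cong (M (fs r)) (punchIn-punchOut c≢a) ⟩
        M (fs r) a                          ≈⟨ cols (fs r) ⟩
        M (fs r) b                          ≡⟨ ≡.cong (M (fs r)) (punchIn-punchOut c≢b) ⟨
        M (fs r) (punchIn c (punchOut c≢b)) ∎

  Det-swap-adjacent : (M : Matrix n) {a b : Fin n} → Adjacent a b → ∀ x y →
                      Det ((M [ a ]≔ x) [ b ]≔ y) ≈ - Det ((M [ a ]≔ y) [ b ]≔ x)
  Det-swap-adjacent {n} M {a} {b} b=1+a x y = +-inverseʳ-unique (V y x) (V x y) (begin
    V y x + V x y                            ≈⟨ +-cong (+-identityˡ _) (+-identityʳ _) ⟨
    (0# + V y x) + (V x y + 0#)              ≈⟨ +-cong (+-congʳ (V-diagonal y)) (+-congˡ (V-diagonal x)) ⟨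
    (V y y + V y x) + (V x y + V x x)        ≈⟨ +-cong (V-additiveʳ y y x) (V-additiveʳ x y x) ⟨
    V y (λ r → y r + x r) + V x (λ r → y r + x r) ≈⟨ +-comm _ _ ⟩
    V x (λ r → y r + x r) + V y (λ r → y r + x r) ≈⟨ V-additiveˡ x y _ ⟨
    V (λ r → x r + y r) (λ r → y r + x r)    ≈⟨ Det-[]≔-cong _ b (λ r → +-comm (y r) (x r)) ⟩
    V (λ r → x r + y r) (λ r → x r + y r)    ≈⟨ V-diagonal _ ⟩
    0#                                       ∎)
    where
    a≢b : a ≢ b
    a≢b = Adjacent⇒≢ b=1+a
    V : (Fin n → Carrier) → (Fin n → Carrier) → Carrier
    V x y = Det ((M [ a ]≔ x) [ b ]≔ y)
    V-diagonal : ∀ z → V z z ≈ 0#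
    V-diagonal z = Det-adjacent-alternating _ b=1+a (λ r → begin
      ((M [ a ]≔ z) [ b ]≔ z) r a ≡⟨ []≔-minimal (M [ a ]≔ z) b z r a≢b ⟩
      (M [ a ]≔ z) r a            ≡⟨ []≔-updates M a z r ⟩
      z r                         ≡⟨ []≔-updates (M [ a ]≔ z) b z r ⟨
      ((M [ a ]≔ z) [ b ]≔ z) r b ∎)
    V-additiveʳ : ∀ x y y′ → V x (λ r → y r + y′ r) ≈ V x y + V x y′
    V-additiveʳ x = Det-additive (M [ a ]≔ x) b
    V-additiveˡ : ∀ x x′ y → V (λ r → x r + x′ r) y ≈ V x y + V x′ y
    V-additiveˡ x x′ y = begin
      V (λ r → x r + x′ r) y                   ≈⟨ Det-cong-≡ ([]≔-comm M a≢b _ y) ⟩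
      Det ((M [ b ]≔ y) [ a ]≔ (λ r → x r + x′ r)) ≈⟨ Det-additive (M [ b ]≔ y) a x x′ ⟩
      Det ((M [ b ]≔ y) [ a ]≔ x) + Det ((M [ b ]≔ y) [ a ]≔ x′)
        ≈⟨ +-cong (Det-cong-≡ ([]≔-comm M a≢b x y)) (Det-cong-≡ ([]≔-comm M a≢b x′ y)) ⟨
      V x y + V x′ y                           ∎

  -- Swap column b with its left neighbour b′ and recurse on the distance between a and b′.
  private
    alternating-at-distance : ∀ d (M : Matrix n) {a b} → toℕ b ≡ suc (d ℕ.+ toℕ a) →
                              (∀ r → M r a ≈ M r b) → Det M ≈ 0#
    alternating-at-distance zero M b=1+a cols = Det-adjacent-alternating M b=1+a cols
    alternating-at-distance {n} (suc d) M {a} {b} b=2+d+a cols = begin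
      Det M                                                     ≈⟨ Det-cong-≡ self ⟨
      Det ((M [ b′ ]≔ (λ r → M r b′)) [ b ]≔ (λ r → M r b))      ≈⟨ Det-swap-adjacent M b′+1=b _ _ ⟩
      - Det N                                                   ≈⟨ -‿cong (alternating-at-distance d N b′=1+d+a N-cols) ⟩
      - 0#                                                      ≈⟨ -0#≈0# ⟩
      0#                                                        ∎
      where
      b′<n : suc (d ℕ.+ toℕ a) ℕ.< n
      b′<n = ℕP.<-trans (ℕP.≤-reflexive (≡.sym b=2+d+a)) (FinP.toℕ<n b)
      b′ : Fin n
      b′ = Fin.fromℕ< b′<n
      b′=1+d+a : toℕ b′ ≡ suc (d ℕ.+ toℕ a)
      b′=1+d+a = FinP.toℕ-fromℕ< b′<n
      b′+1=b : Adjacent b′ b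
      b′+1=b = ≡.trans b=2+d+a (≡.cong suc (≡.sym b′=1+d+a))
      b′≢b : b′ ≢ b
      b′≢b = Adjacent⇒≢ b′+1=b
      a≢b′ : a ≢ b′
      a≢b′ a=b′ = ℕP.m≢1+n+m (toℕ a) (≡.trans (≡.cong toℕ a=b′) b′=1+d+a)
      a≢b : a ≢ b
      a≢b a=b = ℕP.m≢1+n+m (toℕ a) (≡.trans (≡.cong toℕ a=b) b=2+d+a)
      N : Matrix n
      N = (M [ b′ ]≔ (λ r → M r b)) [ b ]≔ (λ r → M r b′)
      self : ∀ r c → ((M [ b′ ]≔ (λ r → M r b′)) [ b ]≔ (λ r → M r b)) r c ≡ M r c
      self r c with c ≟ b
      ... | yes ≡.refl = []≔-updates (M [ b′ ]≔ (λ r → M r b′)) b (λ r → M r b) r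
      ... | no c≢b = ≡.trans ([]≔-minimal (M [ b′ ]≔ (λ r → M r b′)) b (λ r → M r b) r c≢b) ([]≔-self M b′ r c)
      N-cols : ∀ r → N r a ≈ N r b′
      N-cols r = begin
        N r a                          ≡⟨ []≔-minimal (M [ b′ ]≔ (λ r → M r b)) b (λ r → M r b′) r a≢b ⟩
        (M [ b′ ]≔ (λ r → M r b)) r a  ≡⟨ []≔-minimal M b′ (λ r → M r b) r a≢b′ ⟩
        M r a                          ≈⟨ cols r ⟩
        M r b                          ≡⟨ []≔-updates M b′ (λ r → M r b) r ⟨
        (M [ b′ ]≔ (λ r → M r b)) r b′ ≡⟨ []≔-minimal (M [ b′ ]≔ (λ r → M r b)) b (λ r → M r b′) r b′≢b ⟨
        N r b′                         ∎

  Det-alternating : (M : Matrix n) {a b : Fin n} → a ≢ b → (∀ r → M r a ≈ M r b) → Det M ≈ 0#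
  Det-alternating M {a} {b} a≢b cols with ℕP.<-cmp (toℕ a) (toℕ b)
  ... | tri< a<b _ _ = let d , b=1+d+a = <⇒distance a<b in alternating-at-distance d M b=1+d+a cols
  ... | tri≈ _ a=b _ = contradiction (FinP.toℕ-injective a=b) a≢b
  ... | tri> _ _ b<a = let d , a=1+d+b = <⇒distance b<a in alternating-at-distance d M a=1+d+b (λ r → sym (cols r))

  Det-linear-sum : ∀ {k} (M : Matrix n) (j : Fin n) (a : Fin k → Carrier) (u : Fin k → Fin n → Carrier) →
                   Det (M [ j ]≔ (λ r → sum (λ l → a l * u l r))) ≈ sum (λ l → a l * Det (M [ j ]≔ u l))
  Det-linear-sum {k = zero} M j a u = begin
    Det (M [ j ]≔ (λ r → 0#))                           ≈⟨ Det-[]≔-cong M j (λ r → sym 0*0+0*0≈0) ⟩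
    Det (M [ j ]≔ (λ r → 0# * 0# + 0# * 0#))            ≈⟨ Det-linear M j 0# 0# (λ _ → 0#) (λ _ → 0#) ⟩
    0# * Det (M [ j ]≔ (λ _ → 0#)) + 0# * Det (M [ j ]≔ (λ _ → 0#)) ≈⟨ trans (+-cong (zeroˡ _) (zeroˡ _)) (+-identityʳ 0#) ⟩
    0#                                                  ∎
    where
    0*0+0*0≈0 : 0# * 0# + 0# * 0# ≈ 0#
    0*0+0*0≈0 = trans (+-cong (zeroˡ 0#) (zeroˡ 0#)) (+-identityʳ 0#)
  Det-linear-sum {n = n} {k = suc k} M j a u = begin
    Det (M [ j ]≔ (λ r → a fz * u fz r + rest r))        ≈⟨ Det-[]≔-cong M j (λ r → +-congˡ (sym (*-identityˡ (rest r)))) ⟩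
    Det (M [ j ]≔ (λ r → a fz * u fz r + 1# * rest r))   ≈⟨ Det-linear M j (a fz) 1# (u fz) rest ⟩
    a fz * Det (M [ j ]≔ u fz) + 1# * Det (M [ j ]≔ rest) ≈⟨ +-congˡ (trans (*-identityˡ _) (Det-linear-sum M j (a ∘ fs) (u ∘ fs))) ⟩
    a fz * Det (M [ j ]≔ u fz) + sum (λ l → a (fs l) * Det (M [ j ]≔ u (fs l))) ∎
    where
    rest : Fin n → Carrier
    rest r = sum (λ l → a (fs l) * u (fs l) r)

  basis : Fin n → Fin n → Carrier
  basis l r with r ≟ l
  ... | yes _ = 1#
  ... | no _  = 0#

  expand-in-basis : (y : Fin n → Carrier) (r : Fin n) → y r ≈ sum (λ l → y l * basis l r)
  expand-in-basis {n} y r = sym (trans (sum-single (λ l → y l * basis l r) r off-diagonal) diagonal)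
    where
    off-diagonal : ∀ l → l ≢ r → y l * basis l r ≈ 0#
    off-diagonal l l≢r with r ≟ l
    ... | yes r=l = contradiction (≡.sym r=l) l≢r
    ... | no _    = zeroʳ (y l)
    diagonal : y r * basis r r ≈ y r
    diagonal with r ≟ r
    ... | yes _  = *-identityʳ (y r)
    ... | no r≢r = contradiction ≡.refl r≢r

  -- Det (M [ j ]≔ basis l) is the (l, j) cofactor of M.
  cramer : (M : Matrix n) (w : Fin n → Carrier) (j : Fin n) →
           w j * Det M ≈ sum (λ l → (M *ᵥ w) l * Det (M [ j ]≔ basis l))
  cramer {n} M w j = begin
    w j * Det M                                          ≈⟨ *-congˡ (Det-cong-≡ ([]≔-self M j)) ⟨
    w j * Det (M [ j ]≔ column j)                        ≈⟨ sum-single (λ l → w l * Det (M [ j ]≔ column l)) j other-columns ⟨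
    sum (λ l → w l * Det (M [ j ]≔ column l))            ≈⟨ Det-linear-sum M j w column ⟨
    Det (M [ j ]≔ (λ r → sum (λ l → w l * M r l)))       ≈⟨ Det-[]≔-cong M j (λ r → sum-cong-≋ (λ l → *-comm (w l) (M r l))) ⟩
    Det (M [ j ]≔ (M *ᵥ w))                              ≈⟨ Det-[]≔-cong M j (expand-in-basis (M *ᵥ w)) ⟩
    Det (M [ j ]≔ (λ r → sum (λ l → (M *ᵥ w) l * basis l r))) ≈⟨ Det-linear-sum M j (M *ᵥ w) basis ⟩
    sum (λ l → (M *ᵥ w) l * Det (M [ j ]≔ basis l))      ∎
    where
    column : Fin n → Fin n → Carrier
    column l r = M r l
    other-columns : ∀ l → l ≢ j → w l * Det (M [ j ]≔ column l) ≈ 0#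
    other-columns l l≢j = trans (*-congˡ (Det-alternating (M [ j ]≔ column l) (l≢j ∘ ≡.sym) (λ r → reflexive
      (≡.trans ([]≔-updates M j (column l) r) (≡.sym ([]≔-minimal M j (column l) r l≢j)))))) (zeroʳ (w l))

-- Localisations of ℤ inside ℚ

open ≡ using (refl; sym; trans; cong; cong₂)
open Determinant ℚP.+-*-commutativeRing
  using (Matrix; _*ᵥ_; _[_]≔_; -1^_; Det; laplace-term; basis; cramer; *ᵥ-cong; *ᵥ-distrib-+; *ᵥ-scale; []≔-updates; []≔-minimal)
open import Algebra.Properties.Semiring.Sum (CommutativeRing.semiring ℚP.+-*-commutativeRing) using (sum; sum-cong-≗)
open import Algebra.Properties.Ring (CommutativeRing.ring ℚP.+-*-commutativeRing) using (-‿involutive)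

private
  ℚ-ring : AlmostCommutativeRing _ _
  ℚ-ring = fromCommutativeRing ℚP.+-*-commutativeRing (λ _ → nothing)

ι-toℚᵘ : ∀ a → ℚ.toℚᵘ (ι a) ℚᵘ.≃ ℚᵘ.mkℚᵘ a 0
ι-toℚᵘ a = ℚP.toℚᵘ-fromℚᵘ (ℚᵘ.mkℚᵘ a 0)

ι-homo-+ : ∀ a b → ι (a ℤ.+ b) ≡ ι a ℚ.+ ι b
ι-homo-+ a b = ℚP.toℚᵘ-injective (begin
  ℚ.toℚᵘ (ι (a ℤ.+ b))                  ≈⟨ ι-toℚᵘ (a ℤ.+ b) ⟩
  ℚᵘ.mkℚᵘ (a ℤ.+ b) 0                   ≈⟨ ℚᵘ.*≡* (ℤ-solve a b) ⟩
  ℚᵘ.mkℚᵘ a 0 ℚᵘ.+ ℚᵘ.mkℚᵘ b 0          ≈⟨ ℚᵘP.+-cong (ι-toℚᵘ a) (ι-toℚᵘ b) ⟨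
  ℚ.toℚᵘ (ι a) ℚᵘ.+ ℚ.toℚᵘ (ι b)        ≈⟨ ℚP.toℚᵘ-homo-+ (ι a) (ι b) ⟨
  ℚ.toℚᵘ (ι a ℚ.+ ι b)                  ∎)
  where
  open ℚᵘP.≃-Reasoning
  ℤ-solve : ∀ a b → (a ℤ.+ b) ℤ.* + 1 ≡ (a ℤ.* + 1 ℤ.+ b ℤ.* + 1) ℤ.* + 1
  ℤ-solve = ℤ-Solver.solve-∀

ι-homo-* : ∀ a b → ι (a ℤ.* b) ≡ ι a ℚ.* ι b
ι-homo-* a b = ℚP.toℚᵘ-injective (begin
  ℚ.toℚᵘ (ι (a ℤ.* b))                  ≈⟨ ι-toℚᵘ (a ℤ.* b) ⟩
  ℚᵘ.mkℚᵘ a 0 ℚᵘ.* ℚᵘ.mkℚᵘ b 0          ≈⟨ ℚᵘP.*-cong (ι-toℚᵘ a) (ι-toℚᵘ b) ⟨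
  ℚ.toℚᵘ (ι a) ℚᵘ.* ℚ.toℚᵘ (ι b)        ≈⟨ ℚP.toℚᵘ-homo-* (ι a) (ι b) ⟨
  ℚ.toℚᵘ (ι a ℚ.* ι b)                  ∎)
  where open ℚᵘP.≃-Reasoning

fraction-clears : ∀ a b → ι (+ suc b) ℚ.* (a / suc b) ≡ ι a
fraction-clears a b = ℚP.toℚᵘ-injective (begin
  ℚ.toℚᵘ (ι (+ suc b) ℚ.* (a / suc b))                ≈⟨ ℚP.toℚᵘ-homo-* (ι (+ suc b)) (a / suc b) ⟩
  ℚ.toℚᵘ (ι (+ suc b)) ℚᵘ.* ℚ.toℚᵘ (a / suc b)        ≈⟨ ℚᵘP.*-cong (ι-toℚᵘ (+ suc b)) (ℚP.toℚᵘ-fromℚᵘ (ℚᵘ.mkℚᵘ a b)) ⟩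
  ℚᵘ.mkℚᵘ (+ suc b) 0 ℚᵘ.* ℚᵘ.mkℚᵘ a b                  ≈⟨ ℚᵘ.*≡* cross-multiplied ⟩
  ℚᵘ.mkℚᵘ a 0                                             ≈⟨ ι-toℚᵘ a ⟨
  ℚ.toℚᵘ (ι a)                                            ∎)
  where
  open ℚᵘP.≃-Reasoning
  cross-multiplied : (+ suc b ℤ.* a) ℤ.* + 1 ≡ a ℤ.* + (1 ℕ.* suc b)
  cross-multiplied = trans (ℤP.*-identityʳ _) (trans (ℤP.*-comm (+ suc b) a) (cong (λ k → a ℤ.* + k) (sym (ℕP.*-identityˡ (suc b)))))

↧ₙ-clears : ∀ x → ι (+ ℚ.↧ₙ x) ℚ.* x ≡ ι (ℚ.↥ x)
↧ₙ-clears x@(mkℚ a b _) = trans (cong (ι (+ suc b) ℚ.*_) (sym (ℚP.↥p/↧p≡p x))) (fraction-clears a b)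

↧ₙ-∣-clearing : ∀ e a x → ι e ℚ.* x ≡ ι a → ℚ.↧ₙ x ∣ ∣ e ∣
↧ₙ-∣-clearing e a x@(mkℚ n d coprime) ex=a =
  ℕC.coprime-divisor (ℕC.sym (recompute (ℕC.coprime? _ _) coprime))
    (≡.subst (suc d ∣_) (trans (ℤP.abs-* e n) (ℕP.*-comm ∣ e ∣ ∣ n ∣))
      (ℕD.divides ∣ a ∣ (trans (cong ∣_∣ e*n=a*d) (ℤP.abs-* a (+ suc d)))))
  where
  cross : ℚᵘ.mkℚᵘ e 0 ℚᵘ.* ℚᵘ.mkℚᵘ n d ℚᵘ.≃ ℚᵘ.mkℚᵘ a 0
  cross = begin
    ℚᵘ.mkℚᵘ e 0 ℚᵘ.* ℚᵘ.mkℚᵘ n d    ≈⟨ ℚᵘP.*-cong (ι-toℚᵘ e) ℚᵘP.≃-refl ⟨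
    ℚ.toℚᵘ (ι e) ℚᵘ.* ℚ.toℚᵘ x     ≈⟨ ℚP.toℚᵘ-homo-* (ι e) x ⟨
    ℚ.toℚᵘ (ι e ℚ.* x)             ≈⟨ ℚP.toℚᵘ-cong ex=a ⟩
    ℚ.toℚᵘ (ι a)                   ≈⟨ ι-toℚᵘ a ⟩
    ℚᵘ.mkℚᵘ a 0                    ∎
    where open ℚᵘP.≃-Reasoning
  e*n=a*d : e ℤ.* n ≡ a ℤ.* + suc d
  e*n=a*d with cross
  ... | ℚᵘ.*≡* eq = trans (sym (ℤP.*-identityʳ _)) (trans eq (cong (λ k → a ℤ.* + k) (ℕP.*-identityˡ (suc d))))

record Subring (P : ℚ → Set) : Set where
  field
    ι-closed : ∀ a → P (ι a)
    +-closed : ∀ {x y} → P x → P y → P (x ℚ.+ y)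
    *-closed : ∀ {x y} → P x → P y → P (x ℚ.* y)

module _ {P : ℚ → Set} (S : Subring P) where
  open Subring S

  sumℚ-closed : ∀ {k} (f : Fin k → ℚ) → (∀ i → P (f i)) → P (sumℚ f)
  sumℚ-closed {zero}  f f∈P = ι-closed (+ 0)
  sumℚ-closed {suc k} f f∈P = +-closed (f∈P fz) (sumℚ-closed (λ i → f (fs i)) (λ i → f∈P (fs i)))

Integral : ℚ → Set
Integral x = Σ ℤ λ a → x ≡ ι a

integral-subring : Subring Integral
integral-subring = record
  { ι-closed = λ a → a , refl
  ; +-closed = λ { (a , refl) (b , refl) → a ℤ.+ b , sym (ι-homo-+ a b) }
  ; *-closed = λ { (a , refl) (b , refl) → a ℤ.* b , sym (ι-homo-* a b) }
  }

integral⇒subring : ∀ {P} → Subring P → ∀ {x} → Integral x → P x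
integral⇒subring S (a , refl) = Subring.ι-closed S a

record IsMultiplicative (S : ℤ → Set) : Set where
  field
    1∈ : S (+ 1)
    *∈ : ∀ {s t} → S s → S t → S (s ℤ.* t)

Localisation : (ℤ → Set) → ℚ → Set
Localisation S x = Σ ℤ λ s → S s × Σ ℤ λ a → ι s ℚ.* x ≡ ι a

private
  ℚ-+-clearing : ∀ X Y x y → (X ℚ.* Y) ℚ.* (x ℚ.+ y) ≡ (X ℚ.* x) ℚ.* Y ℚ.+ (Y ℚ.* y) ℚ.* X
  ℚ-+-clearing = solve-∀ ℚ-ring
  ℚ-*-clearing : ∀ X Y x y → (X ℚ.* Y) ℚ.* (x ℚ.* y) ≡ (X ℚ.* x) ℚ.* (Y ℚ.* y)
  ℚ-*-clearing = solve-∀ ℚ-ring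
  minus-plus : ∀ x y → x ≡ (x ℚ.- y) ℚ.+ y
  minus-plus x y = sym (trans (ℚP.+-assoc x (ℚ.- y) y) (trans (cong (x ℚ.+_) (ℚP.+-inverseˡ y)) (ℚP.+-identityʳ x)))

localisation-subring : ∀ {S} → IsMultiplicative S → Subring (Localisation S)
localisation-subring {S} mult = record
  { ι-closed = λ a → + 1 , 1∈ , a , ℚP.*-identityˡ (ι a)
  ; +-closed = +-closed
  ; *-closed = *-closed
  }
  where
  open IsMultiplicative mult
  open ≡.≡-Reasoning
  +-closed : ∀ {x y} → Localisation S x → Localisation S y → Localisation S (x ℚ.+ y)
  +-closed {x} {y} (s , s∈S , a , sx=a) (t , t∈S , b , ty=b) = s ℤ.* t , *∈ s∈S t∈S , a ℤ.* t ℤ.+ b ℤ.* s , (begin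
    ι (s ℤ.* t) ℚ.* (x ℚ.+ y)                   ≡⟨ cong (ℚ._* (x ℚ.+ y)) (ι-homo-* s t) ⟩
    (ι s ℚ.* ι t) ℚ.* (x ℚ.+ y)                 ≡⟨ ℚ-+-clearing (ι s) (ι t) x y ⟩
    (ι s ℚ.* x) ℚ.* ι t ℚ.+ (ι t ℚ.* y) ℚ.* ι s ≡⟨ cong₂ (λ u v → u ℚ.* ι t ℚ.+ v ℚ.* ι s) sx=a ty=b ⟩
    ι a ℚ.* ι t ℚ.+ ι b ℚ.* ι s                 ≡⟨ cong₂ ℚ._+_ (ι-homo-* a t) (ι-homo-* b s) ⟨
    ι (a ℤ.* t) ℚ.+ ι (b ℤ.* s)                 ≡⟨ ι-homo-+ (a ℤ.* t) (b ℤ.* s) ⟨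
    ι (a ℤ.* t ℤ.+ b ℤ.* s)                     ∎)
  *-closed : ∀ {x y} → Localisation S x → Localisation S y → Localisation S (x ℚ.* y)
  *-closed {x} {y} (s , s∈S , a , sx=a) (t , t∈S , b , ty=b) = s ℤ.* t , *∈ s∈S t∈S , a ℤ.* b , (begin
    ι (s ℤ.* t) ℚ.* (x ℚ.* y)                   ≡⟨ cong (ℚ._* (x ℚ.* y)) (ι-homo-* s t) ⟩
    (ι s ℚ.* ι t) ℚ.* (x ℚ.* y)                 ≡⟨ ℚ-*-clearing (ι s) (ι t) x y ⟩
    (ι s ℚ.* x) ℚ.* (ι t ℚ.* y)                 ≡⟨ cong₂ ℚ._*_ sx=a ty=b ⟩
    ι a ℚ.* ι b                                 ≡⟨ ι-homo-* a b ⟨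
    ι (a ℤ.* b)                                 ∎)

localisation-mono : ∀ {S T : ℤ → Set} → (∀ {s} → S s → T s) → ∀ {x} → Localisation S x → Localisation T x
localisation-mono S⊆T (s , s∈S , a , sx=a) = s , S⊆T s∈S , a , sx=a

PrimeTo : ℕ → ℤ → Set
PrimeTo p s = ¬ p ∣ ∣ s ∣

primeTo-multiplicative : ∀ {p} → Prime p → IsMultiplicative (PrimeTo p)
primeTo-multiplicative {p} p-prime = record
  { 1∈ = λ p∣1 → ℕPr.¬prime[1] (≡.subst Prime (ℕD.∣1⇒≡1 p∣1) p-prime)
  ; *∈ = λ {s} {t} p∤s p∤t p∣st → [ p∤s , p∤t ]′
           (ℕPr.euclidsLemma ∣ s ∣ ∣ t ∣ p-prime (≡.subst (p ∣_) (ℤP.abs-* s t) p∣st))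
  }

Powers : ℤ → ℤ → Set
Powers d s = Σ ℕ λ k → s ≡ d ℤ.^ k

powers-multiplicative : ∀ d → IsMultiplicative (Powers d)
powers-multiplicative d = record
  { 1∈ = 0 , refl
  ; *∈ = λ { (k , refl) (l , refl) → k ℕ.+ l , sym (ℤP.^-distribˡ-+-* d k l) }
  }

powers⊆ : ∀ {S d} → IsMultiplicative S → S d → ∀ {s} → Powers d s → S s
powers⊆ mult d∈S (zero  , refl) = IsMultiplicative.1∈ mult
powers⊆ mult d∈S (suc k , refl) = IsMultiplicative.*∈ mult d∈S (powers⊆ mult d∈S (k , refl))

-- IntegralAt p is ℤ₍ₚ₎ and Away d is ℤ[1/d]; the ring ℛ of the statement is Away (det A).
IntegralAt : ℕ → ℚ → Set
IntegralAt p = Localisation (PrimeTo p)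

Away : ℤ → ℚ → Set
Away d = Localisation (Powers d)

integralAt-subring : ∀ {p} → Prime p → Subring (IntegralAt p)
integralAt-subring p-prime = localisation-subring (primeTo-multiplicative p-prime)

away-subring : ∀ d → Subring (Away d)
away-subring d = localisation-subring (powers-multiplicative d)

InR⇒Away : ∀ {n} d (v : Vecℚ n) → InR d v → ∀ i → Away d (v i)
InR⇒Away d v v∈R i = let a , k , dᵏv=a = v∈R i in d ℤ.^ k , (k , refl) , a , dᵏv=a

Away⇒InR : ∀ {n} d (v : Vecℚ n) → (∀ i → Away d (v i)) → InR d v
Away⇒InR d v v∈R i with v∈R i
... | s , (k , refl) , a , sv=a = a , k , sv=a

away⇒integralAt : ∀ {p d} → Prime p → PrimeTo p d → ∀ {x} → Away d x → IntegralAt p x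
away⇒integralAt p-prime p∤d = localisation-mono (powers⊆ (primeTo-multiplicative p-prime) p∤d)

away-cancel : ∀ d {x} → Away d (ι d ℚ.* x) → Away d x
away-cancel d {x} (s , (k , refl) , a , dᵏdx=a) = d ℤ.^ suc k , (suc k , refl) , a , (begin
  ι (d ℤ.* d ℤ.^ k) ℚ.* x           ≡⟨ cong (ℚ._* x) (ι-homo-* d (d ℤ.^ k)) ⟩
  (ι d ℚ.* ι (d ℤ.^ k)) ℚ.* x       ≡⟨ reassociate (ι d) (ι (d ℤ.^ k)) x ⟩
  ι (d ℤ.^ k) ℚ.* (ι d ℚ.* x)       ≡⟨ dᵏdx=a ⟩
  ι a                               ∎)
  where
  open ≡.≡-Reasoning
  reassociate : ∀ a b c → (a ℚ.* b) ℚ.* c ≡ b ℚ.* (a ℚ.* c)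
  reassociate = solve-∀ ℚ-ring

inPpow⇒integralAt : ∀ {p N q} → InPpow p N q → IntegralAt p q
inPpow⇒integralAt {p} {N} (a , b , p∤1+b , refl) = + suc b , p∤1+b , a ℤ.* + (p ℕ.^ N) , fraction-clears (a ℤ.* + (p ℕ.^ N)) b

no-prime-divisor⇒≡1 : ∀ n .{{_ : ℕ.NonZero n}} → (∀ p → Prime p → ¬ p ∣ n) → n ≡ 1
no-prime-divisor⇒≡1 n no-divisor with ℕF.factorise n
... | record { factors = [] ; isFactorisation = n=1 } = n=1
... | record { factors = p ∷ ps ; isFactorisation = n=p*ps ; factorsPrime = p-prime ∷ _ } =
  contradiction (≡.subst (p ∣_) (sym n=p*ps) (ℕD.m∣m*n (product ps))) (no-divisor p p-prime)

integralAt-every-prime⇒integral : ∀ {x} → (∀ p → Prime p → IntegralAt p x) → Integral x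
integralAt-every-prime⇒integral {x@(mkℚ a b _)} local = a , (begin
  x                        ≡⟨ ℚP.*-identityˡ x ⟨
  ι (+ 1) ℚ.* x            ≡⟨ cong (λ d → ι (+ d) ℚ.* x) (sym ↧ₙ=1) ⟩
  ι (+ ℚ.↧ₙ x) ℚ.* x       ≡⟨ ↧ₙ-clears x ⟩
  ι a                      ∎)
  where
  open ≡.≡-Reasoning
  ↧ₙ=1 : ℚ.↧ₙ x ≡ 1
  ↧ₙ=1 = no-prime-divisor⇒≡1 (ℚ.↧ₙ x) λ p p-prime p∣↧ →
    let s , p∤s , c , sx=c = local p p-prime in p∤s (ℕD.∣-trans p∣↧ (↧ₙ-∣-clearing s c x sx=c))

-- Integer matrices acting on ℚⁿ

sumℚ≡sum : ∀ {k} (f : Fin k → ℚ) → sumℚ f ≡ sum f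
sumℚ≡sum {zero}  f = refl
sumℚ≡sum {suc k} f = cong (f fz ℚ.+_) (sumℚ≡sum (λ i → f (fs i)))

ι-sumℤ : ∀ {k} (f : Fin k → ℤ) → ι (sumℤ f) ≡ sumℚ (λ i → ι (f i))
ι-sumℤ {zero}  f = refl
ι-sumℤ {suc k} f = trans (ι-homo-+ (f fz) (sumℤ (λ i → f (fs i)))) (cong (ι (f fz) ℚ.+_) (ι-sumℤ (λ i → f (fs i))))

ιᴹ : ∀ {n} → Mat n → Matrix n
ιᴹ A r c = ι (A r c)

ι-sign : ∀ k → ι (sign k) ≡ -1^ k
ι-sign zero = refl
ι-sign (suc zero) = refl
ι-sign (suc (suc k)) = trans (ι-sign k) (sym (-‿involutive (-1^ k)))

ι-det : ∀ {n} (A : Mat n) → ι (det A) ≡ Det (ιᴹ A)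
ι-det {zero}  A = refl
ι-det {suc n} A = trans (ι-sumℤ term) (trans (sumℚ≡sum (λ c → ι (term c))) (sum-cong-≗ termwise))
  where
  minor-det : Fin (suc n) → ℤ
  minor-det c = det (λ r k → A (fs r) (punchIn c k))
  term : Fin (suc n) → ℤ
  term c = sign (toℕ c) ℤ.* (A fz c ℤ.* minor-det c)
  termwise : ∀ c → ι (term c) ≡ -1^ toℕ c ℚ.* (ι (A fz c) ℚ.* Det (λ r k → ι (A (fs r) (punchIn c k))))
  termwise c = trans (ι-homo-* (sign (toℕ c)) (A fz c ℤ.* minor-det c))
    (cong₂ ℚ._*_ (ι-sign (toℕ c))
      (trans (ι-homo-* (A fz c) (minor-det c)) (cong (ι (A fz c) ℚ.*_) (ι-det (λ r k → A (fs r) (punchIn c k))))))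

module _ {P : ℚ → Set} (S : Subring P) where
  open Subring S

  -1^-closed : ∀ k → P (-1^ k)
  -1^-closed k = ≡.subst P (ι-sign k) (ι-closed (sign k))

  Det-closed : ∀ {n} (M : Matrix n) → (∀ r c → P (M r c)) → P (Det M)
  Det-closed {zero}  M M∈P = ι-closed (+ 1)
  Det-closed {suc n} M M∈P = ≡.subst P (sumℚ≡sum (laplace-term M)) (sumℚ-closed S (laplace-term M) λ c →
    *-closed (-1^-closed (toℕ c)) (*-closed (M∈P fz c) (Det-closed _ (λ r k → M∈P (fs r) (punchIn c k)))))

  basis-closed : ∀ {n} (l r : Fin n) → P (basis l r)
  basis-closed l r with r ≟ l
  ... | yes _ = ι-closed (+ 1)
  ... | no _  = ι-closed (+ 0)

record IsLinear {n} (f : Vecℚ n → Vecℚ n) : Set where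
  field
    cong-pointwise : ∀ {u w} → (∀ j → u j ≡ w j) → ∀ i → f u i ≡ f w i
    +-homo         : ∀ u w i → f (λ j → u j ℚ.+ w j) i ≡ f u i ℚ.+ f w i
    *-homo         : ∀ c u i → f (λ j → c ℚ.* u j) i ≡ c ℚ.* f u i

linear-sum : ∀ {n} {f : Vecℚ n → Vecℚ n} → IsLinear f →
             ∀ {k} (c : Fin k → ℚ) (g : Fin k → Vecℚ n) i →
             f (λ j → sumℚ (λ l → c l ℚ.* g l j)) i ≡ sumℚ (λ l → c l ℚ.* f (g l) i)
linear-sum {f = f} L {zero} c g i = begin
  f (λ _ → ℚ.0ℚ) i                   ≡⟨ IsLinear.cong-pointwise L (λ _ → sym (ℚP.*-zeroˡ ℚ.0ℚ)) i ⟩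
  f (λ _ → ℚ.0ℚ ℚ.* ℚ.0ℚ) i          ≡⟨ IsLinear.*-homo L ℚ.0ℚ (λ _ → ℚ.0ℚ) i ⟩
  ℚ.0ℚ ℚ.* f (λ _ → ℚ.0ℚ) i          ≡⟨ ℚP.*-zeroˡ (f (λ _ → ℚ.0ℚ) i) ⟩
  ℚ.0ℚ                               ∎
  where open ≡.≡-Reasoning
linear-sum {f = f} L {suc k} c g i =
  trans (IsLinear.+-homo L (λ j → c fz ℚ.* g fz j) (λ j → sumℚ (λ l → c (fs l) ℚ.* g (fs l) j)) i)
        (cong₂ ℚ._+_ (IsLinear.*-homo L (c fz) (g fz) i) (linear-sum L (λ l → c (fs l)) (λ l → g (fs l)) i))

module _ {n} (A : Mat n) where

  ·ᵥ≡*ᵥ : ∀ u i → (A ·ᵥ u) i ≡ (ιᴹ A *ᵥ u) i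
  ·ᵥ≡*ᵥ u i = sumℚ≡sum (λ j → ι (A i j) ℚ.* u j)

  ·ᵥ-linear : IsLinear (A ·ᵥ_)
  ·ᵥ-linear = record
    { cong-pointwise = λ {u} {w} u=w i → trans (·ᵥ≡*ᵥ u i) (trans (*ᵥ-cong (ιᴹ A) u=w i) (sym (·ᵥ≡*ᵥ w i)))
    ; +-homo = λ u w i → trans (·ᵥ≡*ᵥ _ i)
                           (trans (*ᵥ-distrib-+ (ιᴹ A) u w i) (sym (cong₂ ℚ._+_ (·ᵥ≡*ᵥ u i) (·ᵥ≡*ᵥ w i))))
    ; *-homo = λ c u i → trans (·ᵥ≡*ᵥ _ i) (trans (*ᵥ-scale (ιᴹ A) c u i) (sym (cong (c ℚ.*_) (·ᵥ≡*ᵥ u i))))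
    }

  pow-linear : ∀ m → IsLinear (pow·ᵥ m A)
  pow-linear zero = record
    { cong-pointwise = λ u=w → u=w
    ; +-homo = λ u w i → refl
    ; *-homo = λ c u i → refl
    }
  pow-linear (suc m) = record
    { cong-pointwise = λ u=w → cong-pointwise ·ᵥ-linear (cong-pointwise (pow-linear m) u=w)
    ; +-homo = λ u w i → trans (cong-pointwise ·ᵥ-linear (+-homo (pow-linear m) u w) i) (+-homo ·ᵥ-linear _ _ i)
    ; *-homo = λ c u i → trans (cong-pointwise ·ᵥ-linear (*-homo (pow-linear m) c u) i) (*-homo ·ᵥ-linear c _ i)
    }
    where open IsLinear

  pow-+ : ∀ a b u i → pow·ᵥ (a ℕ.+ b) A u i ≡ pow·ᵥ a A (pow·ᵥ b A u) i
  pow-+ zero    b u i = refl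
  pow-+ (suc a) b u i = IsLinear.cong-pointwise ·ᵥ-linear (pow-+ a b u) i

  module _ {P : ℚ → Set} (S : Subring P) where

    ·ᵥ-closed : ∀ u → (∀ j → P (u j)) → ∀ i → P ((A ·ᵥ u) i)
    ·ᵥ-closed u u∈P i = sumℚ-closed S _ (λ j → Subring.*-closed S (Subring.ι-closed S (A i j)) (u∈P j))

    pow-closed : ∀ m u → (∀ j → P (u j)) → ∀ i → P (pow·ᵥ m A u i)
    pow-closed zero    u u∈P = u∈P
    pow-closed (suc m) u u∈P = ·ᵥ-closed (pow·ᵥ m A u) (pow-closed m u u∈P)

-- G_A and its p-adic closures

Eventually : (ℕ → Set) → Set
Eventually P = Σ ℕ λ m → ∀ K → m ℕ.≤ K → P K

eventually-× : ∀ {P Q : ℕ → Set} → Eventually P → Eventually Q → Eventually (λ K → P K × Q K)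
eventually-× (m₁ , P-after) (m₂ , Q-after) =
  m₁ ℕ.⊔ m₂ , λ K m≤K → P-after K (ℕP.m⊔n≤o⇒m≤o m₁ m₂ m≤K) , Q-after K (ℕP.m⊔n≤o⇒n≤o m₁ m₂ m≤K)

eventually-∀ : ∀ {k} {P : Fin k → ℕ → Set} → (∀ i → Eventually (P i)) → Eventually (λ K → ∀ i → P i K)
eventually-∀ {zero}  _  = 0 , λ _ _ ()
eventually-∀ {suc k} ev with eventually-× (ev fz) (eventually-∀ (λ i → ev (fs i)))
... | m , after = m , λ { K m≤K fz → proj₁ (after K m≤K) ; K m≤K (fs i) → proj₂ (after K m≤K) i }

eventually-∀≤ : ∀ D {P : ℕ → ℕ → Set} → (∀ q → q ℕ.≤ D → Eventually (P q)) → Eventually (λ K → ∀ q → q ℕ.≤ D → P q K)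
eventually-∀≤ zero ev with ev 0 ℕ.z≤n
... | m , after = m , λ { K m≤K .0 ℕ.z≤n → after K m≤K }
eventually-∀≤ (suc D) ev with eventually-× (eventually-∀≤ D (λ q q≤D → ev q (ℕP.m≤n⇒m≤1+n q≤D))) (ev (suc D) ℕP.≤-refl)
... | m , after = m , λ K m≤K q q≤1+D → case ℕP.m≤n⇒m<n∨m≡n q≤1+D of λ
  { (inj₁ (ℕ.s≤s q≤D)) → proj₁ (after K m≤K) q q≤D
  ; (inj₂ refl)         → proj₂ (after K m≤K) }

module _ {n} (A : Mat n) where

  pow-closed-eventually : ∀ {P} → Subring P → ∀ m u → (∀ j → P (pow·ᵥ m A u j)) →
                          Eventually (λ K → ∀ i → P (pow·ᵥ K A u i))
  pow-closed-eventually {P} S m u Aᵐu∈P = m , λ K m≤K i →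
    ≡.subst (λ t → P (pow·ᵥ t A u i)) (ℕP.m∸n+n≡m m≤K)
      (≡.subst P (sym (pow-+ A (K ℕ.∸ m) m u i)) (pow-closed A S (K ℕ.∸ m) (pow·ᵥ m A u) Aᵐu∈P i))

  G⇒eventually-integral : ∀ {u} → G A u → Eventually (λ K → ∀ i → Integral (pow·ᵥ K A u i))
  G⇒eventually-integral {u} (+ m , x , Aᵐu=x) = pow-closed-eventually integral-subring m u (λ j → x j , Aᵐu=x j)
  G⇒eventually-integral {u} (ℤ.-[1+ m ] , x , u=Aᵐ⁺¹x) = pow-closed-eventually integral-subring 0 u λ j →
    ≡.subst Integral (sym (u=Aᵐ⁺¹x j)) (pow-closed A integral-subring (suc m) (toℚᵛ x) (λ l → x l , refl) j)

  G⇒gbar : ∀ {p} → Prime p → ∀ {v} → G A v → InGbar A p v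
  G⇒gbar {p} p-prime {v} v∈G = 1 , (λ _ → v) , (λ _ → one) , (λ _ → v∈G) , λ N → 0 , λ m _ j →
    + 0 , 0 , IsMultiplicative.1∈ (primeTo-multiplicative p-prime) , (begin
      v j ℚ.- (ι (+ 1) ℚ.* v j ℚ.+ ℚ.0ℚ)    ≡⟨ cong (λ x → v j ℚ.- x) (trans (ℚP.+-identityʳ _) (ℚP.*-identityˡ (v j))) ⟩
      v j ℚ.- v j                           ≡⟨ ℚP.+-inverseʳ (v j) ⟩
      ℚ.0ℚ                                  ≡⟨ cong (_/ 1) (ℤP.*-zeroˡ (+ (p ℕ.^ N))) ⟨
      (+ 0 ℤ.* + (p ℕ.^ N)) / 1             ∎)
    where
    open ≡.≡-Reasoning
    one : ℤₚ p
    one = record { seq = λ _ → + 1 ; coh = λ m → (p ℕ.^ m) ℕD.∣0 }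

  -- Precision p⁰ suffices: v − s has entries in ℤ₍ₚ₎.
  gbar⇒eventually-integralAt : ∀ {p} → Prime p → ∀ {v} → InGbar A p v →
                               Eventually (λ K → ∀ i → IntegralAt p (pow·ᵥ K A v i))
  gbar⇒eventually-integralAt {p} p-prime {v} (k , g , c , g∈G , v≈Σcg)
    with eventually-∀ (λ l → G⇒eventually-integral (g∈G l))
  ... | m , g-integral = m , λ K m≤K i →
    ≡.subst (IntegralAt p) (sym (split K i)) (+-closed (pow-closed A ℤ₍ₚ₎ K r r∈ℤ₍ₚ₎ i) (Aᴷs∈ℤ₍ₚ₎ K m≤K i))
    where
    ℤ₍ₚ₎ : Subring (IntegralAt p)
    ℤ₍ₚ₎ = integralAt-subring p-prime
    open Subring ℤ₍ₚ₎
    M : ℕ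
    M = proj₁ (v≈Σcg 0)
    c₀ : Fin k → ℚ
    c₀ l = ι (ℤₚ.seq (c l) M)
    s r : Vecℚ n
    s j = sumℚ (λ l → c₀ l ℚ.* g l j)
    r j = v j ℚ.- s j
    r∈ℤ₍ₚ₎ : ∀ j → IntegralAt p (r j)
    r∈ℤ₍ₚ₎ j = inPpow⇒integralAt {N = 0} (proj₂ (v≈Σcg 0) M ℕP.≤-refl j)
    Aᴷs∈ℤ₍ₚ₎ : ∀ K → m ℕ.≤ K → ∀ i → IntegralAt p (pow·ᵥ K A s i)
    Aᴷs∈ℤ₍ₚ₎ K m≤K i = ≡.subst (IntegralAt p) (sym (linear-sum (pow-linear A K) c₀ g i))
      (sumℚ-closed ℤ₍ₚ₎ _ λ l → *-closed (ι-closed (ℤₚ.seq (c l) M)) (integral⇒subring ℤ₍ₚ₎ (g-integral K m≤K l i)))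
    split : ∀ K i → pow·ᵥ K A v i ≡ pow·ᵥ K A r i ℚ.+ pow·ᵥ K A s i
    split K i = trans (IsLinear.cong-pointwise (pow-linear A K) (λ j → minus-plus (v j) (s j)) i)
                      (IsLinear.+-homo (pow-linear A K) r s i)

  eventually-integralAt⇒G : ∀ {v} → (∀ p → Prime p → Eventually (λ K → ∀ i → IntegralAt p (pow·ᵥ K A v i))) → G A v
  eventually-integralAt⇒G {v} local = + K , (λ i → proj₁ (integral i)) , (λ i → proj₂ (integral i))
    where
    LocalAt : ℕ → ℕ → Set
    LocalAt q K = Prime q → ∀ i → IntegralAt q (pow·ᵥ K A v i)
    denominator-primes : Eventually (λ K → ∀ j q → q ℕ.≤ ℚ.↧ₙ (v j) → LocalAt q K)
    denominator-primes = eventually-∀ λ j → eventually-∀≤ (ℚ.↧ₙ (v j)) λ q _ → case ℕPr.prime? q of λ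
      { (yes q-prime) → let m , after = local q q-prime in m , λ K m≤K _ → after K m≤K
      ; (no ¬prime)   → 0 , λ _ _ q-prime → contradiction q-prime ¬prime }
    K : ℕ
    K = proj₁ denominator-primes
    localAt : ∀ p → Prime p → ∀ i → IntegralAt p (pow·ᵥ K A v i)
    localAt p p-prime with FinP.any? (λ j → p ℕD.∣? ℚ.↧ₙ (v j))
    ... | yes (j , p∣↧) = proj₂ denominator-primes K ℕP.≤-refl j p (ℕD.∣⇒≤ p∣↧) p-prime
    ... | no p∤↧ = pow-closed A (integralAt-subring p-prime) K v
      (λ j → + ℚ.↧ₙ (v j) , ¬∃⟶∀¬ p∤↧ j , ℚ.↥ (v j) , ↧ₙ-clears (v j))
    integral : ∀ i → Integral (pow·ᵥ K A v i)
    integral i = integralAt-every-prime⇒integral (λ p p-prime → localAt p p-prime i)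

  ·ᵥ-reflects-away : ∀ w → (∀ i → Away (det A) ((A ·ᵥ w) i)) → ∀ j → Away (det A) (w j)
  ·ᵥ-reflects-away w Aw∈R j = away-cancel (det A) (≡.subst (Away (det A)) adjugate-formula
    (sumℚ-closed R _ λ l → *-closed (≡.subst (Away (det A)) (·ᵥ≡*ᵥ A w l) (Aw∈R l)) (Det-closed R (ιᴹ A [ j ]≔ basis l) (entries l))))
    where
    R : Subring (Away (det A))
    R = away-subring (det A)
    open Subring R
    cofactor-terms : Fin n → ℚ
    cofactor-terms l = (ιᴹ A *ᵥ w) l ℚ.* Det (ιᴹ A [ j ]≔ basis l)
    adjugate-formula : sumℚ cofactor-terms ≡ ι (det A) ℚ.* w j
    adjugate-formula = begin
      sumℚ cofactor-terms                                      ≡⟨ sumℚ≡sum cofactor-terms ⟩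
      sum cofactor-terms                                       ≡⟨ cramer (ιᴹ A) w j ⟨
      w j ℚ.* Det (ιᴹ A)                                       ≡⟨ cong (w j ℚ.*_) (ι-det A) ⟨
      w j ℚ.* ι (det A)                                        ≡⟨ ℚP.*-comm (w j) (ι (det A)) ⟩
      ι (det A) ℚ.* w j                                        ∎
      where open ≡.≡-Reasoning
    entries : ∀ l r c → Away (det A) ((ιᴹ A [ j ]≔ basis l) r c)
    entries l r c with c ≟ j
    ... | yes refl = ≡.subst (Away (det A)) (sym ([]≔-updates (ιᴹ A) j (basis l) r)) (basis-closed R l r)
    ... | no c≢j   = ≡.subst (Away (det A)) (sym ([]≔-minimal (ιᴹ A) j (basis l) r c≢j)) (ι-closed (A r c))

  pow-reflects-away : ∀ m u → (∀ i → Away (det A) (pow·ᵥ m A u i)) → ∀ i → Away (det A) (u i)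
  pow-reflects-away zero    u Aᵐu∈R = Aᵐu∈R
  pow-reflects-away (suc m) u Aᵐu∈R = pow-reflects-away m u (·ᵥ-reflects-away (pow·ᵥ m A u) Aᵐu∈R)

  G⇒away : ∀ {v} → G A v → ∀ i → Away (det A) (v i)
  G⇒away {v} (+ m , x , Aᵐv=x) = pow-reflects-away m v λ i →
    ≡.subst (Away (det A)) (sym (Aᵐv=x i)) (Subring.ι-closed (away-subring (det A)) (x i))
  G⇒away {v} (ℤ.-[1+ m ] , x , v=Aᵐ⁺¹x) i = ≡.subst (Away (det A)) (sym (v=Aᵐ⁺¹x i))
    (pow-closed A (away-subring (det A)) (suc m) (toℚᵛ x) (λ j → Subring.ι-closed (away-subring (det A)) (x j)) i)

  gbar-everywhere⇒G : ∀ {v} → (∀ p → Prime p → InGbar A p v) → G A v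
  gbar-everywhere⇒G v∈Gbar = eventually-integralAt⇒G λ p p-prime → gbar⇒eventually-integralAt p-prime (v∈Gbar p p-prime)

  away∩gbar⇒G : ∀ {v} → (∀ i → Away (det A) (v i)) → (∀ p → Prime p → p ∣ ∣ det A ∣ → InGbar A p v) → G A v
  away∩gbar⇒G {v} v∈R v∈Gbar = eventually-integralAt⇒G λ p p-prime → case p ℕD.∣? ∣ det A ∣ of λ
    { (yes p∣d) → gbar⇒eventually-integralAt p-prime (v∈Gbar p p-prime p∣d)
    ; (no p∤d)  → pow-closed-eventually (integralAt-subring p-prime) 0 v (λ i → away⇒integralAt p-prime p∤d (v∈R i)) }

corollary2p4 : (n : ℕ) (A : Mat n) → det A ≢ + 0 →
    ((v : Vecℚ n) → G A v ⇔ ((p : ℕ) → Prime p → InGbar A p v))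
    × ((v : Vecℚ n) → G A v ⇔ (InR (det A) v × ((p : ℕ) → Prime p → p ∣ ∣ det A ∣ → InGbar A p v)))
corollary2p4 n A _ =
  (λ v → mk⇔ (λ v∈G p p-prime → G⇒gbar A p-prime v∈G) (gbar-everywhere⇒G A)) ,
  (λ v → mk⇔ (λ v∈G → Away⇒InR (det A) v (G⇒away A v∈G) , λ p p-prime _ → G⇒gbar A p-prime v∈G)
             (λ (v∈R , v∈Gbar) → away∩gbar⇒G A (InR⇒Away (det A) v v∈R) v∈Gbar))
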